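{- Let $G=(V,E)$ be a finite graph and $v\in V$. Then $$\frac{\gamma_{coe}(G-v)+\gamma_{coe}(G/v)}{2}-\deg(v)+1\leq \gamma_{coe}(G)\leq \frac{\gamma_{coe}(G-v)+\gamma_{coe}(G/v)}{2}+\deg(v)+1,$$ where $\deg(v)$ is the degree of $v$ in $G$.
   Context: All graphs are finite, without loops and without directed edges. For a graph $H=(V,E)$, a set $D\subseteq V$ is a dominating set if every vertex in $V\setminus D$ is adjacent to at least one vertex of $D$. A dominating set $D$ is a co-even dominating set if every vertex $u\in V\setminus D$ has even degree in $H$. The co-even domination number $\gamma_{coe}(H)$ is the minimum cardinality of a co-even dominating set of $H$. The graph $G-v$ is obtained from $G$ by deleting $v$ and all edges incident to $v$. The vertex contraction $G/v$ is obtained from $G$ by deleting $v$ and making the open neighbourhood $N_G(v)$ a clique; no parallel edges are created (already adjacent neighbours remain simply adjacent). -}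

module Defs where

open import Data.Bool using (Bool; true; false; _∨_; _∧_; not)
open import Data.Nat using (ℕ; suc)
open import Data.Nat.Divisibility using (_∣_)
open import Data.Fin using (Fin; punchIn; _≟_)
open import Data.Fin.Subset using (Subset; _∈_; _∉_; ∣_∣)
open import Data.Vec using (tabulate)
open import Data.Product using (Σ; _×_)
open import Relation.Binary.PropositionalEquality using (_≡_)
open import Relation.Nullary using (¬_)
open import Relation.Nullary.Decidable using (⌊_⌋)

Adj : ℕ → Set
Adj n = Fin n → Fin n → Bool

IsSimpleGraph : {n : ℕ} → Adj n → Set
IsSimpleGraph {n} G = ((i j : Fin n) → G i j ≡ G j i) × ((i : Fin n) → G i i ≡ false)

N : {n : ℕ} → Adj n → Fin n → Subset n
N G i = tabulate (G i)

deg : {n : ℕ} → Adj n → Fin n → ℕ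
deg G i = ∣ N G i ∣

IsDominating : {n : ℕ} → Adj n → Subset n → Set
IsDominating {n} G D = (u : Fin n) → u ∉ D → Σ (Fin n) (λ w → w ∈ D × G u w ≡ true)

IsCoEvenDominating : {n : ℕ} → Adj n → Subset n → Set
IsCoEvenDominating {n} G D = IsDominating G D × ((u : Fin n) → u ∉ D → 2 ∣ deg G u)

-- k is the co-even domination number of G (the minimum cardinality of a
-- co-even dominating set; it always exists since V itself is one)
IsCoEvenDomNumber : {n : ℕ} → Adj n → ℕ → Set
IsCoEvenDomNumber {n} G k =
  Σ (Subset n) (λ D → IsCoEvenDominating G D × ∣ D ∣ ≡ k)
  × ((D : Subset n) → IsCoEvenDominating G D → k Data.Nat.≤ ∣ D ∣)

deleteV : {n : ℕ} → Adj (suc n) → Fin (suc n) → Adj n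
deleteV G v i j = G (punchIn v i) (punchIn v j)

-- G / v : delete v and make N(v) a clique (no loops, no parallel edges)
contractV : {n : ℕ} → Adj (suc n) → Fin (suc n) → Adj n
contractV G v i j =
  G (punchIn v i) (punchIn v j)
  ∨ (not ⌊ i ≟ j ⌋ ∧ (G v (punchIn v i) ∧ G v (punchIn v j)))

module Submission where

-- Let H be G − v or G / v; outside N(v) both coincide with G − v, degrees included, since such vertices
-- are not adjacent to v. A co-even dominating set D′ of H lifts to D′ ∪ N(v) ∪ {v} in G, so
-- γ(G) ≤ γ(H) + deg v + 1. Conversely a co-even dominating set D of G restricts to (D − v) ∪ N(v) in H;
-- putting N(v) into the set means only vertices where H and G − v agree need to be dominated, and the set
-- has at most |D| + deg v − 1 elements, because either v ∈ D or v has a neighbour in D that is counted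
-- twice. Adding the resulting bounds for G − v and for G / v gives the theorem.

open import Defs
open import Data.Bool using (Bool; true; false; not)
open import Data.Bool.Properties using (¬-not; ∧-zeroʳ; ∨-identityʳ)
open import Data.Fin using (Fin; zero; suc; punchIn; punchOut; _≟_)
open import Data.Fin.Properties using (punchInᵢ≢i; punchOut-punchIn; punchIn-punchOut)
open import Data.Fin.Subset using (Subset; inside; outside; _∈_; _∉_; _⊆_; _∪_; _∩_; ⁅_⁆; ∣_∣)
open import Data.Fin.Subset.Properties
  using (x∈p∪q⁺; x∈p∩q⁺; x∈⁅y⁆⇒x≡y; ∣⁅x⁆∣≡1; p⊆q⇒∣p∣≤∣q∣; _∈?_)
open import Data.Nat using (ℕ; suc; _+_; _*_; _≤_; _<_; s≤s)
open import Data.Nat.Divisibility using (_∣_)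
open import Data.Nat.Properties using (+-suc; +-comm; m≤m+n; +-mono-≤; ≤-trans; +-monoʳ-≤; module ≤-Reasoning)
open import Data.Nat.Tactic.RingSolver using (solve-∀)
open import Data.Product using (Σ; _×_; _,_; proj₁; proj₂)
open import Data.Sum using (inj₁; inj₂)
open import Data.Vec using (Vec; []; _∷_; lookup; tabulate; insertAt; removeAt)
open import Data.Vec.Properties
  using ([]=⇒lookup; lookup⇒[]=; lookup∘tabulate; tabulate∘lookup; tabulate-cong;
         insertAt-lookup; insertAt-punchIn; removeAt-punchOut; insertAt-removeAt)
open import Function using (_∘_; _⇔_; mk⇔; Equivalence)
open import Relation.Binary.PropositionalEquality
  using (_≡_; _≢_; refl; sym; trans; cong; cong₂; subst; module ≡-Reasoning)
open import Relation.Nullary using (Dec; yes; no; ⌊_⌋)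

open Equivalence using (from)

private
  variable
    n : ℕ

∈-lookup-cong : {m : ℕ} {p : Subset m} {q : Subset n} {x : Fin m} {y : Fin n} → lookup p x ≡ lookup q y → x ∈ p ⇔ y ∈ q
∈-lookup-cong {p = p} {q} {x} {y} e = mk⇔
  (λ x∈p → lookup⇒[]= y q (trans (sym e) ([]=⇒lookup x∈p)))
  (λ y∈q → lookup⇒[]= x p (trans e ([]=⇒lookup y∈q)))

∈-tabulate : {f : Fin n → Bool} {x : Fin n} → x ∈ tabulate f ⇔ f x ≡ true
∈-tabulate {f = f} {x} = mk⇔
  (λ x∈ → trans (sym (lookup∘tabulate f x)) ([]=⇒lookup x∈))
  (λ fx → lookup⇒[]= x (tabulate f) (trans (lookup∘tabulate f x) fx))

lookup-removeAt : {A : Set} (xs : Vec A (suc n)) (i : Fin (suc n)) (j : Fin n) →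
                  lookup (removeAt xs i) j ≡ lookup xs (punchIn i j)
lookup-removeAt xs i j =
  trans (cong (lookup (removeAt xs i)) (sym (punchOut-punchIn i)))
        (removeAt-punchOut xs (punchInᵢ≢i i j ∘ sym))

∈-removeAt : {p : Subset (suc n)} {i : Fin (suc n)} {x : Fin n} → x ∈ removeAt p i ⇔ punchIn i x ∈ p
∈-removeAt {p = p} {i} {x} = ∈-lookup-cong (lookup-removeAt p i x)

punchIn-∈-insertAt : {p : Subset n} {i : Fin (suc n)} {b : Bool} {x : Fin n} →
                     punchIn i x ∈ insertAt p i b ⇔ x ∈ p
punchIn-∈-insertAt {p = p} {i} {b} {x} = ∈-lookup-cong (insertAt-punchIn p i b x)

∈-insertAt : (p : Subset n) (i : Fin (suc n)) → i ∈ insertAt p i inside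
∈-insertAt p i = lookup⇒[]= i (insertAt p i inside) (insertAt-lookup p i inside)

∣x∷y∷p∣≡∣y∷x∷p∣ : ∀ x y (p : Subset n) → ∣ x ∷ y ∷ p ∣ ≡ ∣ y ∷ x ∷ p ∣
∣x∷y∷p∣≡∣y∷x∷p∣ true  true  p = refl
∣x∷y∷p∣≡∣y∷x∷p∣ true  false p = refl
∣x∷y∷p∣≡∣y∷x∷p∣ false true  p = refl
∣x∷y∷p∣≡∣y∷x∷p∣ false false p = refl

∣insertAt∣ : ∀ (p : Subset n) i x → ∣ insertAt p i x ∣ ≡ ∣ x ∷ p ∣
∣insertAt∣ p           zero    x = refl
∣insertAt∣ (true ∷ p)  (suc i) x = trans (cong suc (∣insertAt∣ p i x)) (∣x∷y∷p∣≡∣y∷x∷p∣ true x p)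
∣insertAt∣ (false ∷ p) (suc i) x = trans (∣insertAt∣ p i x) (∣x∷y∷p∣≡∣y∷x∷p∣ false x p)

∣p∣≡∣p[i]∷removeAt∣ : ∀ (p : Subset (suc n)) i → ∣ p ∣ ≡ ∣ lookup p i ∷ removeAt p i ∣
∣p∣≡∣p[i]∷removeAt∣ p i =
  trans (cong ∣_∣ (sym (insertAt-removeAt p i))) (∣insertAt∣ (removeAt p i) i (lookup p i))

∉⇒lookup≡outside : {p : Subset n} {x : Fin n} → x ∉ p → lookup p x ≡ outside
∉⇒lookup≡outside {p = p} {x} x∉p = ¬-not (x∉p ∘ lookup⇒[]= x p)

x∈p⇒∣p∣≡1+∣removeAt∣ : {x : Fin (suc n)} (p : Subset (suc n)) → x ∈ p → ∣ p ∣ ≡ suc ∣ removeAt p x ∣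
x∈p⇒∣p∣≡1+∣removeAt∣ {x = x} p x∈p =
  trans (∣p∣≡∣p[i]∷removeAt∣ p x) (cong (λ b → ∣ b ∷ removeAt p x ∣) ([]=⇒lookup x∈p))

x∉p⇒∣p∣≡∣removeAt∣ : {x : Fin (suc n)} (p : Subset (suc n)) → x ∉ p → ∣ p ∣ ≡ ∣ removeAt p x ∣
x∉p⇒∣p∣≡∣removeAt∣ {x = x} p x∉p =
  trans (∣p∣≡∣p[i]∷removeAt∣ p x) (cong (λ b → ∣ b ∷ removeAt p x ∣) (∉⇒lookup≡outside x∉p))

removeAt-tabulate : {A : Set} (f : Fin (suc n) → A) (i : Fin (suc n)) →
                    removeAt (tabulate f) i ≡ tabulate (f ∘ punchIn i)
removeAt-tabulate f i = trans (sym (tabulate∘lookup _))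
  (tabulate-cong (λ j → trans (lookup-removeAt (tabulate f) i j) (lookup∘tabulate f (punchIn i j))))

∣tabulate∣-punchIn : ∀ (f : Fin (suc n) → Bool) i → ∣ tabulate f ∣ ≡ ∣ f i ∷ tabulate (f ∘ punchIn i) ∣
∣tabulate∣-punchIn f i = trans (∣p∣≡∣p[i]∷removeAt∣ (tabulate f) i)
  (cong₂ (λ x p → ∣ x ∷ p ∣) (lookup∘tabulate f i) (removeAt-tabulate f i))

∣p∪q∣+∣p∩q∣≡∣p∣+∣q∣ : ∀ (p q : Subset n) → ∣ p ∪ q ∣ + ∣ p ∩ q ∣ ≡ ∣ p ∣ + ∣ q ∣
∣p∪q∣+∣p∩q∣≡∣p∣+∣q∣ [] [] = refl
∣p∪q∣+∣p∩q∣≡∣p∣+∣q∣ (true ∷ p) (true ∷ q) = cong suc (begin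
  ∣ p ∪ q ∣ + suc ∣ p ∩ q ∣   ≡⟨ +-suc _ _ ⟩
  suc (∣ p ∪ q ∣ + ∣ p ∩ q ∣) ≡⟨ cong suc (∣p∪q∣+∣p∩q∣≡∣p∣+∣q∣ p q) ⟩
  suc (∣ p ∣ + ∣ q ∣)         ≡⟨ +-suc _ _ ⟨
  ∣ p ∣ + suc ∣ q ∣           ∎)
  where open ≡-Reasoning
∣p∪q∣+∣p∩q∣≡∣p∣+∣q∣ (true  ∷ p) (false ∷ q) = cong suc (∣p∪q∣+∣p∩q∣≡∣p∣+∣q∣ p q)
∣p∪q∣+∣p∩q∣≡∣p∣+∣q∣ (false ∷ p) (true  ∷ q) =
  trans (cong suc (∣p∪q∣+∣p∩q∣≡∣p∣+∣q∣ p q)) (sym (+-suc _ _))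
∣p∪q∣+∣p∩q∣≡∣p∣+∣q∣ (false ∷ p) (false ∷ q) = ∣p∪q∣+∣p∩q∣≡∣p∣+∣q∣ p q

∣p∪q∣≤∣p∣+∣q∣ : ∀ (p q : Subset n) → ∣ p ∪ q ∣ ≤ ∣ p ∣ + ∣ q ∣
∣p∪q∣≤∣p∣+∣q∣ p q = begin
  ∣ p ∪ q ∣             ≤⟨ m≤m+n _ _ ⟩
  ∣ p ∪ q ∣ + ∣ p ∩ q ∣ ≡⟨ ∣p∪q∣+∣p∩q∣≡∣p∣+∣q∣ p q ⟩
  ∣ p ∣ + ∣ q ∣         ∎
  where open ≤-Reasoning

x∈p⇒1≤∣p∣ : {x : Fin n} {p : Subset n} → x ∈ p → 1 ≤ ∣ p ∣
x∈p⇒1≤∣p∣ {x = x} {p} x∈p = subst (_≤ ∣ p ∣) (∣⁅x⁆∣≡1 x) (p⊆q⇒∣p∣≤∣q∣ ⁅x⁆⊆p)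
  where
  ⁅x⁆⊆p : ⁅ x ⁆ ⊆ p
  ⁅x⁆⊆p y∈⁅x⁆ = subst (_∈ p) (sym (x∈⁅y⁆⇒x≡y x y∈⁅x⁆)) x∈p

x∈p∩q⇒∣p∪q∣<∣p∣+∣q∣ : {x : Fin n} (p q : Subset n) → x ∈ p → x ∈ q → ∣ p ∪ q ∣ < ∣ p ∣ + ∣ q ∣
x∈p∩q⇒∣p∪q∣<∣p∣+∣q∣ p q x∈p x∈q = begin
  suc ∣ p ∪ q ∣         ≡⟨ +-comm 1 _ ⟩
  ∣ p ∪ q ∣ + 1         ≤⟨ +-monoʳ-≤ ∣ p ∪ q ∣ (x∈p⇒1≤∣p∣ (x∈p∩q⁺ (x∈p , x∈q))) ⟩
  ∣ p ∪ q ∣ + ∣ p ∩ q ∣ ≡⟨ ∣p∪q∣+∣p∩q∣≡∣p∣+∣q∣ p q ⟩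
  ∣ p ∣ + ∣ q ∣         ∎
  where open ≤-Reasoning

N⁻ : Adj (suc n) → Fin (suc n) → Subset n
N⁻ G v = tabulate (G v ∘ punchIn v)

∉N⁻⇒non-adjacent : {G : Adj (suc n)} {v : Fin (suc n)} {u : Fin n} → u ∉ N⁻ G v → G v (punchIn v u) ≡ false
∉N⁻⇒non-adjacent u∉N = ¬-not (u∉N ∘ from ∈-tabulate)

-- G / v, like G − v itself, satisfies this; the bounds below need nothing more about H.
AgreesOffN : Adj (suc n) → Fin (suc n) → Adj n → Set
AgreesOffN {n} G v H = (u : Fin n) → u ∉ N⁻ G v → (j : Fin n) → H u j ≡ deleteV G v u j

contractV-agreesOffN : (G : Adj (suc n)) (v : Fin (suc n)) → AgreesOffN G v (contractV G v)
contractV-agreesOffN G v u u∉N j rewrite ∉N⁻⇒non-adjacent {G = G} u∉N | ∧-zeroʳ (not ⌊ u ≟ j ⌋) =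
  ∨-identityʳ (deleteV G v u j)

CoEvenDominatedBy : Adj n → Subset n → Fin n → Set
CoEvenDominatedBy {n} G D u = Σ (Fin n) (λ w → w ∈ D × G u w ≡ true) × 2 ∣ deg G u

coEvenDominating : {G : Adj n} {D : Subset n} → (∀ u → u ∉ D → CoEvenDominatedBy G D u) → IsCoEvenDominating G D
coEvenDominating dominated = (λ u u∉D → proj₁ (dominated u u∉D)) , (λ u u∉D → proj₂ (dominated u u∉D))

coEvenDominated : {G : Adj n} {D : Subset n} {u : Fin n} → IsCoEvenDominating G D → u ∉ D → CoEvenDominatedBy G D u
coEvenDominated (dominating , co-even) u∉D = dominating _ u∉D , co-even _ u∉D

module _ {G : Adj (suc n)} (simple : IsSimpleGraph G) (v : Fin (suc n)) where

  private
    G-sym = proj₁ simple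
    G-loopless = proj₂ simple

  deg≡∣N⁻∣ : deg G v ≡ ∣ N⁻ G v ∣
  deg≡∣N⁻∣ = trans (∣tabulate∣-punchIn (G v) v) (cong (λ b → ∣ b ∷ N⁻ G v ∣) (G-loopless v))

  adjacent⇒≢ : {x w : Fin (suc n)} → G x w ≡ true → G x v ≡ false → v ≢ w
  adjacent⇒≢ xw xv refl with trans (sym xw) xv
  ... | ()

  module _ {H : Adj n} (agree : AgreesOffN G v H) where

    deg-agreesOffN : {u : Fin n} → u ∉ N⁻ G v → deg H u ≡ deg G (punchIn v u)
    deg-agreesOffN {u} u∉N = begin
      ∣ tabulate (H u) ∣                          ≡⟨ cong ∣_∣ (tabulate-cong (agree u u∉N)) ⟩
      ∣ tabulate (row ∘ punchIn v) ∣              ≡⟨ cong (λ b → ∣ b ∷ tabulate (row ∘ punchIn v) ∣) non-adjacent ⟨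
      ∣ row v ∷ tabulate (row ∘ punchIn v) ∣      ≡⟨ ∣tabulate∣-punchIn row v ⟨
      ∣ tabulate row ∣                            ∎
      where
      open ≡-Reasoning
      row : Fin (suc n) → Bool
      row = G (punchIn v u)
      non-adjacent : row v ≡ false
      non-adjacent = trans (G-sym _ v) (∉N⁻⇒non-adjacent {G = G} u∉N)

    lift-dominated : {D′ : Subset n} {u : Fin n} → u ∉ N⁻ G v → CoEvenDominatedBy H D′ u
                   → CoEvenDominatedBy G (insertAt (D′ ∪ N⁻ G v) v inside) (punchIn v u)
    lift-dominated {u = u} u∉N ((w , w∈D′ , Huw) , even) =
      (punchIn v w , from punchIn-∈-insertAt (x∈p∪q⁺ (inj₁ w∈D′)) , trans (sym (agree u u∉N w)) Huw)
      , subst (2 ∣_) (deg-agreesOffN u∉N) even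

    lift : {D′ : Subset n} → IsCoEvenDominating H D′
         → Σ (Subset (suc n)) λ D → IsCoEvenDominating G D × ∣ D ∣ ≤ suc (∣ D′ ∣ + deg G v)
    lift {D′} D′-dom = D , coEvenDominating dominated , card
      where
      D = insertAt (D′ ∪ N⁻ G v) v inside

      dominated : ∀ x → x ∉ D → CoEvenDominatedBy G D x
      dominated x x∉D =
        subst (CoEvenDominatedBy G D) (punchIn-punchOut v≢x)
              (lift-dominated (u∉ ∘ x∈p∪q⁺ ∘ inj₂) (coEvenDominated D′-dom (u∉ ∘ x∈p∪q⁺ ∘ inj₁)))
        where
        v≢x : v ≢ x
        v≢x refl = x∉D (∈-insertAt _ v)
        u∉ : punchOut v≢x ∉ D′ ∪ N⁻ G v
        u∉ = x∉D ∘ subst (_∈ D) (punchIn-punchOut v≢x) ∘ from punchIn-∈-insertAt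

      card : ∣ D ∣ ≤ suc (∣ D′ ∣ + deg G v)
      card = begin
        ∣ D ∣                        ≡⟨ ∣insertAt∣ (D′ ∪ N⁻ G v) v inside ⟩
        suc ∣ D′ ∪ N⁻ G v ∣          ≤⟨ s≤s (∣p∪q∣≤∣p∣+∣q∣ D′ (N⁻ G v)) ⟩
        suc (∣ D′ ∣ + ∣ N⁻ G v ∣)    ≡⟨ cong (λ k → suc (∣ D′ ∣ + k)) deg≡∣N⁻∣ ⟨
        suc (∣ D′ ∣ + deg G v)       ∎
        where open ≤-Reasoning

    restrict-dominated : {D : Subset (suc n)} {u : Fin n} → u ∉ N⁻ G v → CoEvenDominatedBy G D (punchIn v u)
                       → CoEvenDominatedBy H (removeAt D v ∪ N⁻ G v) u
    restrict-dominated {D} {u} u∉N ((w , w∈D , Gw) , even) =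
      (punchOut v≢w , x∈p∪q⁺ (inj₁ (from ∈-removeAt w∈D′)) , trans (agree u u∉N _) Gw′)
      , subst (2 ∣_) (sym (deg-agreesOffN u∉N)) even
      where
      v≢w : v ≢ w
      v≢w = adjacent⇒≢ Gw (trans (G-sym _ v) (∉N⁻⇒non-adjacent {G = G} u∉N))
      w∈D′ : punchIn v (punchOut v≢w) ∈ D
      w∈D′ = subst (_∈ D) (sym (punchIn-punchOut v≢w)) w∈D
      Gw′ : G (punchIn v u) (punchIn v (punchOut v≢w)) ≡ true
      Gw′ = subst (λ x → G (punchIn v u) x ≡ true) (sym (punchIn-punchOut v≢w)) Gw

    restrict : {D : Subset (suc n)} → IsCoEvenDominating G D
             → Σ (Subset n) λ D′ → IsCoEvenDominating H D′ × ∣ D′ ∣ < ∣ D ∣ + deg G v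
    restrict {D} D-dom = D′ , coEvenDominating dominated , card (v ∈? D)
      where
      D′ = removeAt D v ∪ N⁻ G v

      dominated : ∀ u → u ∉ D′ → CoEvenDominatedBy H D′ u
      dominated u u∉D′ =
        restrict-dominated (u∉D′ ∘ x∈p∪q⁺ ∘ inj₂) (coEvenDominated D-dom (u∉D′ ∘ x∈p∪q⁺ ∘ inj₁ ∘ from ∈-removeAt))

      open ≤-Reasoning

      card : Dec (v ∈ D) → ∣ D′ ∣ < ∣ D ∣ + deg G v
      card (yes v∈D) = begin
        suc ∣ D′ ∣                           ≤⟨ s≤s (∣p∪q∣≤∣p∣+∣q∣ (removeAt D v) (N⁻ G v)) ⟩
        suc ∣ removeAt D v ∣ + ∣ N⁻ G v ∣    ≡⟨ cong₂ _+_ (x∈p⇒∣p∣≡1+∣removeAt∣ D v∈D) deg≡∣N⁻∣ ⟨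
        ∣ D ∣ + deg G v                      ∎
      -- the neighbour of v dominating it lies in both parts of D′
      card (no v∉D) with coEvenDominated D-dom v∉D
      ... | (w , w∈D , Gvw) , _ = begin
        suc ∣ D′ ∣                         ≤⟨ x∈p∩q⇒∣p∪q∣<∣p∣+∣q∣ (removeAt D v) (N⁻ G v) w′∈D w′∈N ⟩
        ∣ removeAt D v ∣ + ∣ N⁻ G v ∣      ≡⟨ cong₂ _+_ (x∉p⇒∣p∣≡∣removeAt∣ D v∉D) deg≡∣N⁻∣ ⟨
        ∣ D ∣ + deg G v                    ∎
        where
        v≢w : v ≢ w
        v≢w = adjacent⇒≢ Gvw (G-loopless v)
        w≡ : w ≡ punchIn v (punchOut v≢w)
        w≡ = sym (punchIn-punchOut v≢w)
        w′∈D : punchOut v≢w ∈ removeAt D v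
        w′∈D = from ∈-removeAt (subst (_∈ D) w≡ w∈D)
        w′∈N : punchOut v≢w ∈ N⁻ G v
        w′∈N = from ∈-tabulate (subst (λ x → G v x ≡ true) w≡ Gvw)

    coEvenDomNumber-bounds : {a c : ℕ} → IsCoEvenDomNumber H a → IsCoEvenDomNumber G c
                           → (a < c + deg G v) × (c ≤ suc (a + deg G v))
    coEvenDomNumber-bounds ((Dₐ , Dₐ-dom , refl) , a-min) ((Dc , Dc-dom , refl) , c-min) =
      let (Dₐ′ , Dₐ′-dom , ∣Dₐ′∣≤) = restrict Dc-dom
          (Dc′ , Dc′-dom , ∣Dc′∣≤) = lift Dₐ-dom
      in ≤-trans (s≤s (a-min Dₐ′ Dₐ′-dom)) ∣Dₐ′∣≤ , ≤-trans (c-min Dc′ Dc′-dom) ∣Dc′∣≤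

sum-of-bounds : {a b c d : ℕ} → a < c + d → b < c + d → c ≤ suc (a + d) → c ≤ suc (b + d)
              → (a + b + 2 ≤ 2 * c + 2 * d) × (2 * c ≤ a + b + 2 * d + 2)
sum-of-bounds {a} {b} {c} {d} a<c+d b<c+d c≤a+d c≤b+d = lower , upper
  where
  open ≤-Reasoning
  lower : a + b + 2 ≤ 2 * c + 2 * d
  lower = begin
    a + b + 2                   ≡⟨ lhs-lower a b ⟩
    suc a + suc b               ≤⟨ +-mono-≤ a<c+d b<c+d ⟩
    (c + d) + (c + d)           ≡⟨ rhs-lower c d ⟩
    2 * c + 2 * d               ∎
    where
    lhs-lower : ∀ a b → a + b + 2 ≡ suc a + suc b
    lhs-lower = solve-∀
    rhs-lower : ∀ c d → (c + d) + (c + d) ≡ 2 * c + 2 * d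
    rhs-lower = solve-∀
  upper : 2 * c ≤ a + b + 2 * d + 2
  upper = begin
    2 * c                       ≡⟨ double c ⟩
    c + c                       ≤⟨ +-mono-≤ c≤a+d c≤b+d ⟩
    suc (a + d) + suc (b + d)   ≡⟨ rhs-upper a b d ⟩
    a + b + 2 * d + 2           ∎
    where
    double : ∀ c → 2 * c ≡ c + c
    double = solve-∀
    rhs-upper : ∀ a b d → suc (a + d) + suc (b + d) ≡ a + b + 2 * d + 2
    rhs-upper = solve-∀

corollary3p3 : {n : ℕ} (G : Adj (suc n)) → IsSimpleGraph G → (v : Fin (suc n))
    → (a b c : ℕ)
    → IsCoEvenDomNumber (deleteV G v) a
    → IsCoEvenDomNumber (contractV G v) b
    → IsCoEvenDomNumber G c
    → (a + b + 2 ≤ 2 * c + 2 * deg G v) × (2 * c ≤ a + b + 2 * deg G v + 2)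
corollary3p3 G simple v a b c γ-deleteV γ-contractV γ =
  let (a<c+d , c≤a+d) = coEvenDomNumber-bounds simple v (λ _ _ _ → refl) γ-deleteV γ
      (b<c+d , c≤b+d) = coEvenDomNumber-bounds simple v (contractV-agreesOffN G v) γ-contractV γ
  in sum-of-bounds a<c+d b<c+d c≤a+d c≤b+d
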